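{- Let $G=(V,E)$ be a finite graph with $n$ vertices and maximum degree $\Delta$, and let $q\ge \Delta+2$ colors be available. Consider the self-organizing network coloring game on $G$ with $q$ colors played with the greedy and selfish strategy, and let $(X_t)_{t\in\mathbb{N}}$ be the process of payoff vectors $X_t=(U_1(t),\dots,U_n(t))\in\{0,1\}^n$, regarded as a Markov chain on the set $S$ of attainable payoff vectors. Then $(X_t)$ is an absorbing Markov chain: the state $(1,1,\dots,1)$ is absorbing, every other state is transient, and from every other state the state $(1,1,\dots,1)$ is reached with positive probability.
   Context: Network coloring game (NCG): players are the vertices $1,\dots,n$ of a graph $G$; $N(i)$ denotes the set of neighbours of $i$. There are $q$ colors. The game runs in discrete rounds $t=0,1,2,\dots$; at round $t$ each player $i$ holds a color $l_i(t)$, and its payoff is $U_i(t)=1$ if $l_i(t)\neq l_j(t)$ for all $j\in N(i)$, and $U_i(t)=0$ otherwise. Greedy and selfish strategy: a player with payoff $1$ keeps its color (it has no incentive to change), while a player with payoff $0$ chooses its next color uniformly at random among the colors not used by any of its neighbours in the previous round, independently of the other players. A state $i$ of a Markov chain $(Z_t)$ is absorbing if $\Pr[Z_{t+k}=i\mid Z_t=i]=1$ for all $k$, and transient otherwise; the chain is absorbing if it has at least one absorbing state accessible from every transient state. Since it is impossible for exactly $n-1$ players to have payoff $1$, the state space $S$ consists of the binary vectors of length $n$ excluding those with exactly one zero. -}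

module Defs where

open import Data.Nat using (ℕ; zero; suc; _≤_)
open import Data.Fin using (Fin; _≟_)
open import Data.Bool using (Bool; true; false; not; _∧_; if_then_else_)
open import Data.List using (List; []; _∷_; foldr; map)
open import Data.Bool.ListAction using (any)
open import Data.List using (allFin) public
open import Data.Integer using (+_)
open import Data.Rational using (ℚ; 0ℚ; 1ℚ; _*_; _<_; _/_)
open import Data.Product using (∃; _×_)
open import Relation.Nullary using (¬_)
open import Relation.Nullary.Decidable using (⌊_⌋)
open import Relation.Binary.PropositionalEquality using (_≡_)

record Graph (n : ℕ) : Set where
  field
    adj    : Fin n → Fin n → Bool
    sym    : ∀ i j → adj i j ≡ adj j i
    irrefl : ∀ i → adj i i ≡ false
open Graph public

countB : {A : Set} → (A → Bool) → List A → ℕ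
countB p []       = 0
countB p (x ∷ xs) = if p x then suc (countB p xs) else countB p xs

_==F_ : {q : ℕ} → Fin q → Fin q → Bool
a ==F b = ⌊ a ≟ b ⌋

degree : {n : ℕ} → Graph n → Fin n → ℕ
degree {n} G i = countB (adj G i) (allFin n)

Config : ℕ → ℕ → Set
Config n q = Fin n → Fin q

payoff : {n q : ℕ} → Graph n → Config n q → Fin n → Bool
payoff {n} G c i = not (any (λ j → adj G i j ∧ (c i ==F c j)) (allFin n))

AllHappy : {n q : ℕ} → Graph n → Config n q → Set
AllHappy G c = ∀ i → payoff G c i ≡ true

free : {n q : ℕ} → Graph n → Config n q → Fin n → Fin q → Bool
free {n} G c i a = not (any (λ j → adj G i j ∧ (c j ==F a)) (allFin n))

-- 1/k as a rational, with the (irrelevant) convention inv 0 = 0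
inv : ℕ → ℚ
inv zero    = 0ℚ
inv (suc k) = + 1 / suc k

playerProb : {n q : ℕ} → Graph n → Config n q → Config n q → Fin n → ℚ
playerProb {n} {q} G c c' i =
  if payoff G c i
  then (if c' i ==F c i then 1ℚ else 0ℚ)
  else (if free G c i (c' i) then inv (countB (free G c i) (allFin q)) else 0ℚ)

-- one-step transition probability of the (Markov) color process;
-- players choose independently, so it is a product over the players
P : {n q : ℕ} → Graph n → Config n q → Config n q → ℚ
P {n} G c c' = foldr _*_ 1ℚ (map (playerProb G c c') (allFin n))

data Reach {n q : ℕ} (G : Graph n) : Config n q → Config n q → Set where
  here : ∀ {c} → Reach G c c
  step : ∀ {c c' d} → 0ℚ < P G c c' → Reach G c' d → Reach G c d

-- As long as some player k is unhappy, the strategy can with positive probability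
-- produce a round in which every happy player keeps its colour, k takes a colour
-- free for it, and every other unhappy player takes a colour free for it and
-- different from k's new colour (possible as such a player has at most Δ
-- forbidden colours plus one more to avoid, out of q ≥ Δ + 2).  Happy players stay
-- happy, since a neighbour only ever moves to a colour it does not see around it,
-- and k becomes happy; so the number of unhappy players strictly decreases.
module Submission where

open import Defs hiding (sym)
open import Data.Nat using (ℕ; suc; _≤_; _<_; _+_; z≤n; s≤s)
open import Data.Nat.Properties using (≤-trans; +-comm; m≤n⇒m≤1+n; m<n⇒m<1+n; ≤⇒≯)
open import Data.Nat.Induction using (<-wellFounded)
open import Data.Fin using (Fin; _≟_)
open import Data.Fin.Properties using (injective⇒≤; all?; ¬∀⟶∃¬)
open import Data.Bool using (Bool; true; false; not; _∧_; if_then_else_)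
import Data.Bool.Properties as Bool
open import Data.Bool.ListAction using (any)
open import Data.List using (List; []; _∷_; foldr; map; length; lookup; filterᵇ)
open import Data.List.Properties using (length-map)
open import Data.List.Membership.Propositional using (_∈_; _∉_)
open import Data.List.Membership.Propositional.Properties using (∈-allFin; ∈-map⁺; ∈-filter⁺)
open import Data.List.Relation.Unary.Any using (here; there; index; any?)
open import Data.List.Relation.Unary.Any.Properties using (lookup-index)
open import Data.Rational using (ℚ; 0ℚ; 1ℚ; _*_; Positive)
import Data.Rational as ℚ
open import Data.Rational.Properties using (positive⁻¹; *-identityˡ; pos*pos⇒pos; normalize-pos)
open import Data.Product using (∃; _×_; _,_; proj₁; proj₂)
open import Function using (_∘_; Equivalence)
open import Induction.WellFounded using (Acc; acc)
open import Relation.Nullary using (¬_; yes; no; contradiction)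
open import Relation.Nullary.Decidable using (dec-true; dec-false; isYes≗does)
open import Relation.Binary.PropositionalEquality using (_≡_; _≢_; refl; sym; trans; cong; subst)

module _ {A : Set} where

  not-any⇒ : (p : A → Bool) (xs : List A) → not (any p xs) ≡ true →
             ∀ {x} → x ∈ xs → p x ≡ false
  not-any⇒ p (y ∷ ys) h x∈ with p y in py
  not-any⇒ p (y ∷ ys) h (here refl) | false = py
  not-any⇒ p (y ∷ ys) h (there x∈)  | false = not-any⇒ p ys h x∈
  not-any⇒ p (y ∷ ys) () x∈         | true

  not-any⇐ : (p : A → Bool) (xs : List A) → (∀ {x} → x ∈ xs → p x ≡ false) →
             not (any p xs) ≡ true
  not-any⇐ p []       _ = refl
  not-any⇐ p (y ∷ ys) h rewrite h (here refl) = not-any⇐ p ys (h ∘ there)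

  countB≡length-filterᵇ : (p : A → Bool) (xs : List A) → countB p xs ≡ length (filterᵇ p xs)
  countB≡length-filterᵇ p []       = refl
  countB≡length-filterᵇ p (x ∷ xs) with p x
  ... | true  = cong suc (countB≡length-filterᵇ p xs)
  ... | false = countB≡length-filterᵇ p xs

  countB-pos : (p : A → Bool) (xs : List A) → ∀ {x} → x ∈ xs → p x ≡ true → 0 < countB p xs
  countB-pos p (y ∷ ys) x∈ px with p y in py
  ... | true = s≤s z≤n
  countB-pos p (y ∷ ys) (here refl) px | false = contradiction (trans (sym px) py) λ ()
  countB-pos p (y ∷ ys) (there x∈)  px | false = countB-pos p ys x∈ px

  module _ (p r : A → Bool) (p⇒r : ∀ {x} → p x ≡ true → r x ≡ true) where

    countB-mono : (xs : List A) → countB p xs ≤ countB r xs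
    countB-mono []       = z≤n
    countB-mono (y ∷ ys) with p y in py | r y in ry
    ... | true  | true  = s≤s (countB-mono ys)
    ... | true  | false = contradiction (trans (sym (p⇒r py)) ry) λ ()
    ... | false | true  = m≤n⇒m≤1+n (countB-mono ys)
    ... | false | false = countB-mono ys

    countB-mono-< : (xs : List A) → ∀ {x} → x ∈ xs → p x ≡ false → r x ≡ true →
                    countB p xs < countB r xs
    countB-mono-< (y ∷ ys) (here refl) px rx rewrite px | rx = s≤s (countB-mono ys)
    countB-mono-< (y ∷ ys) (there x∈)  px rx with p y in py | r y in ry
    ... | true  | true  = s≤s (countB-mono-< ys x∈ px rx)
    ... | true  | false = contradiction (trans (sym (p⇒r py)) ry) λ ()
    ... | false | true  = m<n⇒m<1+n (countB-mono-< ys x∈ px rx)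
    ... | false | false = countB-mono-< ys x∈ px rx

  product-pos : (f : A → ℚ) (xs : List A) → (∀ x → Positive (f x)) →
                Positive (foldr _*_ 1ℚ (map f xs))
  product-pos f []       _   = _
  product-pos f (x ∷ xs) pos = pos*pos⇒pos (f x) {{pos x}} _ {{product-pos f xs pos}}

  product-one : (f : A → ℚ) (xs : List A) → (∀ x → f x ≡ 1ℚ) →
                foldr _*_ 1ℚ (map f xs) ≡ 1ℚ
  product-one f []       _   = refl
  product-one f (x ∷ xs) one rewrite one x | product-one f xs one = *-identityˡ 1ℚ

length<⇒∃∉ : ∀ {q} (L : List (Fin q)) → length L < q → ∃ λ b → b ∉ L
length<⇒∃∉ {q} L L<q with all? (λ b → any? (b ≟_) L)
... | no ¬all = ¬∀⟶∃¬ q _ (λ b → any? (b ≟_) L) ¬all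
... | yes all = contradiction L<q (≤⇒≯ (injective⇒≤ index-injective))
  where
    index-injective : ∀ {a b} → index (all a) ≡ index (all b) → a ≡ b
    index-injective {a} {b} eq =
      trans (lookup-index (all a)) (trans (cong (lookup L) eq) (sym (lookup-index (all b))))

≡⇒==F-true : ∀ {q} {a b : Fin q} → a ≡ b → (a ==F b) ≡ true
≡⇒==F-true {a = a} {b} a≡b = trans (isYes≗does (a ≟ b)) (dec-true (a ≟ b) a≡b)

≢⇒==F-false : ∀ {q} {a b : Fin q} → a ≢ b → (a ==F b) ≡ false
≢⇒==F-false {a = a} {b} a≢b = trans (isYes≗does (a ≟ b)) (dec-false (a ≟ b) a≢b)

inv-pos : ∀ {k} → 0 < k → Positive (inv k)
inv-pos {suc k} _ = normalize-pos 1 (suc k)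

module _ {n q : ℕ} (G : Graph n) where

  -- payoff and free both say that no neighbour of i satisfies some test f
  module _ (i : Fin n) (f : Fin n → Bool) where

    noNeighbour⇒ : not (any (λ j → adj G i j ∧ f j) (allFin n)) ≡ true →
                   ∀ {j} → adj G i j ≡ true → f j ≡ false
    noNeighbour⇒ h {j} i~j with not-any⇒ _ (allFin n) h (∈-allFin j)
    ... | e rewrite i~j = e

    noNeighbour⇐ : (∀ {j} → adj G i j ≡ true → f j ≡ false) →
                   not (any (λ j → adj G i j ∧ f j) (allFin n)) ≡ true
    noNeighbour⇐ h = not-any⇐ _ (allFin n) λ {j} _ → conj j
      where
        conj : ∀ j → adj G i j ∧ f j ≡ false
        conj j with adj G i j in i~j
        ... | true  = h i~j
        ... | false = refl

  payoff≡true⇒ : ∀ {c : Config n q} {i j} → payoff G c i ≡ true → adj G i j ≡ true → c i ≢ c j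
  payoff≡true⇒ {c} {i} h i~j ci≡cj =
    contradiction (trans (sym (≡⇒==F-true ci≡cj)) (noNeighbour⇒ i _ h i~j)) λ ()

  payoff≡true⇐ : ∀ {c : Config n q} {i} → (∀ {j} → adj G i j ≡ true → c i ≢ c j) →
                 payoff G c i ≡ true
  payoff≡true⇐ {c} {i} h = noNeighbour⇐ i _ λ i~j → ≢⇒==F-false (h i~j)

  free⇒ : ∀ {c : Config n q} {i a j} → free G c i a ≡ true → adj G i j ≡ true → c j ≢ a
  free⇒ {c} {i} {a} {j} h i~j cj≡a =
    contradiction (trans (sym (≡⇒==F-true cj≡a)) (noNeighbour⇒ i _ h i~j)) λ ()

  free⇐ : ∀ {c : Config n q} {i a} → (∀ {j} → adj G i j ≡ true → c j ≢ a) → free G c i a ≡ true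
  free⇐ {c} {i} {a} h = noNeighbour⇐ i _ λ {j} i~j → ≢⇒==F-false (h i~j)

  neighbourColours : Config n q → Fin n → List (Fin q)
  neighbourColours c i = map c (filterᵇ (adj G i) (allFin n))

  length-neighbourColours : ∀ (c : Config n q) i → length (neighbourColours c i) ≡ degree G i
  length-neighbourColours c i =
    trans (length-map c (filterᵇ (adj G i) (allFin n)))
          (sym (countB≡length-filterᵇ (adj G i) (allFin n)))

  ∉neighbourColours⇒free : ∀ {c i a} → a ∉ neighbourColours c i → free G c i a ≡ true
  ∉neighbourColours⇒free {c} {i} a∉ = free⇐ λ {j} i~j cj≡a →
    a∉ (subst (_∈ _) cj≡a (∈-map⁺ c (∈-filter⁺ _ (∈-allFin j) (Equivalence.from Bool.T-≡ i~j))))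

  -- The configurations d that the greedy and selfish strategy plays from c with positive probability.
  record GreedyMove (c d : Config n q) : Set where
    field
      keeps : ∀ {j} → payoff G c j ≡ true → d j ≡ c j
      frees : ∀ {j} → payoff G c j ≡ false → free G c j (d j) ≡ true
  open GreedyMove

  module _ {c d : Config n q} (move : GreedyMove c d) where

    greedyMove⇒P-pos : 0ℚ ℚ.< P G c d
    greedyMove⇒P-pos = positive⁻¹ _ {{product-pos (playerProb G c d) (allFin n) playerProb-pos}}
      where
        playerProb-pos : ∀ j → Positive (playerProb G c d j)
        playerProb-pos j with payoff G c j in hj
        ... | true rewrite keeps move hj | ≡⇒==F-true {a = c j} refl = _
        ... | false rewrite frees move hj =
          inv-pos (countB-pos (free G c j) (allFin q) (∈-allFin (d j)) (frees move hj))

    greedyMove-keepsHappy : ∀ {j} → payoff G c j ≡ true → payoff G d j ≡ true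
    greedyMove-keepsHappy {j} hj = payoff≡true⇐ λ {m} j~m dj≡dm → case-m m j~m dj≡dm
      where
        case-m : ∀ m → adj G j m ≡ true → d j ≢ d m
        case-m m j~m dj≡dm with payoff G c m in hm
        ... | true  = payoff≡true⇒ hj j~m
                        (trans (sym (keeps move hj)) (trans dj≡dm (keeps move hm)))
        ... | false = free⇒ (frees move hm) (trans (Graph.sym G m j) j~m)
                        (trans (sym (keeps move hj)) dj≡dm)

    greedyMove-satisfies : ∀ {k} → payoff G c k ≡ false →
                           (∀ {m} → adj G k m ≡ true → payoff G c m ≡ false → d m ≢ d k) →
                           payoff G d k ≡ true
    greedyMove-satisfies {k} hk apart = payoff≡true⇐ λ {m} k~m dk≡dm → case-m m k~m dk≡dm
      where
        case-m : ∀ m → adj G k m ≡ true → d k ≢ d m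
        case-m m k~m dk≡dm with payoff G c m in hm
        ... | true  = free⇒ (frees move hk) k~m (trans (sym (keeps move hm)) (sym dk≡dm))
        ... | false = apart k~m hm (sym dk≡dm)

  unhappyCount : Config n q → ℕ
  unhappyCount c = countB (not ∘ payoff G c) (allFin n)

  greedyMove-unhappyCount-< : ∀ {c d k} → GreedyMove c d → payoff G c k ≡ false → payoff G d k ≡ true →
                              unhappyCount d < unhappyCount c
  greedyMove-unhappyCount-< {c} {d} {k} move hk hd =
    countB-mono-< (not ∘ payoff G d) (not ∘ payoff G c) stillUnhappy (allFin n) (∈-allFin k)
      (cong not hd) (cong not hk)
    where
      stillUnhappy : ∀ {j} → not (payoff G d j) ≡ true → not (payoff G c j) ≡ true
      stillUnhappy {j} ud with payoff G c j in hj
      ... | false = refl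
      ... | true  = contradiction (trans (sym (cong not (greedyMove-keepsHappy move hj))) ud) λ ()

  AllHappy⇒P≡1 : ∀ {c : Config n q} → AllHappy G c → P G c c ≡ 1ℚ
  AllHappy⇒P≡1 {c} happy = product-one (playerProb G c c) (allFin n) stays
    where
      stays : ∀ i → playerProb G c c i ≡ 1ℚ
      stays i rewrite happy i | ≡⇒==F-true {a = c i} refl = refl

  ¬AllHappy⇒∃unhappy : ∀ {c : Config n q} → ¬ AllHappy G c → ∃ λ k → payoff G c k ≡ false
  ¬AllHappy⇒∃unhappy {c} ¬happy with ¬∀⟶∃¬ n _ (λ i → payoff G c i Bool.≟ true) ¬happy
  ... | k , ¬hk = k , Bool.¬-not ¬hk

module _ {n q Δ : ℕ} (G : Graph n) (deg≤Δ : ∀ i → degree G i ≤ Δ) (Δ+2≤q : Δ + 2 ≤ q) where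

  ∃free≢ : (c : Config n q) (i : Fin n) (x : Fin q) → ∃ λ b → free G c i b ≡ true × b ≢ x
  ∃free≢ c i x =
    let b , b∉ = length<⇒∃∉ (x ∷ neighbourColours G c i) length<q
    in b , ∉neighbourColours⇒free G (b∉ ∘ there) , b∉ ∘ here
    where
      length<q : suc (length (neighbourColours G c i)) < q
      length<q rewrite length-neighbourColours G c i =
        ≤-trans (s≤s (s≤s (deg≤Δ i))) (subst (_≤ q) (+-comm Δ 2) Δ+2≤q)

  module Improvement (c : Config n q) (k : Fin n) where

    a : Fin q
    a = proj₁ (∃free≢ c k (c k))

    pick : Fin n → Fin q
    pick j with j ≟ k
    ... | yes _ = a
    ... | no  _ = proj₁ (∃free≢ c j a)

    pick-free : ∀ j → free G c j (pick j) ≡ true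
    pick-free j with j ≟ k
    ... | yes refl = proj₁ (proj₂ (∃free≢ c k (c k)))
    ... | no  _    = proj₁ (proj₂ (∃free≢ c j a))

    pick-k : pick k ≡ a
    pick-k with k ≟ k
    ... | yes _   = refl
    ... | no  k≢k = contradiction refl k≢k

    pick-avoids : ∀ {m} → m ≢ k → pick m ≢ a
    pick-avoids {m} m≢k with m ≟ k
    ... | yes m≡k = contradiction m≡k m≢k
    ... | no  _   = proj₂ (proj₂ (∃free≢ c m a))

    d : Config n q
    d j = if payoff G c j then c j else pick j

    d-by-payoff : ∀ {j b} → payoff G c j ≡ b → d j ≡ (if b then c j else pick j)
    d-by-payoff {j} = cong (λ b → if b then c j else pick j)

    move : GreedyMove G c d
    move .GreedyMove.keeps hj = d-by-payoff hj
    move .GreedyMove.frees {j} hj =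
      subst (λ x → free G c j x ≡ true) (sym (d-by-payoff hj)) (pick-free j)

    apart : payoff G c k ≡ false → ∀ {m} → adj G k m ≡ true → payoff G c m ≡ false → d m ≢ d k
    apart hk {m} k~m hm dm≡dk =
      pick-avoids m≢k (trans (sym (d-by-payoff hm)) (trans dm≡dk (trans (d-by-payoff hk) pick-k)))
      where
        m≢k : m ≢ k
        m≢k refl = contradiction (trans (sym k~m) (Graph.irrefl G k)) λ ()

  improvingMove : ∀ {c : Config n q} {k} → payoff G c k ≡ false →
                  ∃ λ d → GreedyMove G c d × payoff G d k ≡ true
  improvingMove {c} {k} hk = d , move , greedyMove-satisfies G move hk (apart hk)
    where open Improvement c k

  reachAllHappy : (c : Config n q) → Acc _<_ (unhappyCount G c) →
                  ∃ λ d → Reach G c d × AllHappy G d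
  reachAllHappy c (acc smaller) with all? (λ i → payoff G c i Bool.≟ true)
  ... | yes happy = c , here , happy
  ... | no ¬happy with ¬AllHappy⇒∃unhappy G ¬happy
  ... | k , hk with improvingMove hk
  ... | d , move , hd with reachAllHappy d (smaller (greedyMove-unhappyCount-< G move hk hd))
  ... | e , d↝e , happy = e , step (greedyMove⇒P-pos G move) d↝e , happy

proposition1 : (n q Δ : ℕ) (G : Graph n) → (∀ i → degree G i ≤ Δ) → Δ + 2 ≤ q →
    ((c : Config n q) → AllHappy G c → P G c c ≡ 1ℚ)
    × ((c : Config n q) → ¬ AllHappy G c →
         ∃ λ d → Reach G c d × ∃ λ i → payoff G d i ≢ payoff G c i)
    × ((c : Config n q) → ¬ AllHappy G c → ∃ λ d → Reach G c d × AllHappy G d)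
proposition1 n q Δ G deg≤Δ Δ+2≤q = (λ c → AllHappy⇒P≡1 G) , changes , absorbed
  where
    absorbed : (c : Config n q) → ¬ AllHappy G c → ∃ λ d → Reach G c d × AllHappy G d
    absorbed c _ = reachAllHappy G deg≤Δ Δ+2≤q c (<-wellFounded _)

    changes : (c : Config n q) → ¬ AllHappy G c →
              ∃ λ d → Reach G c d × ∃ λ i → payoff G d i ≢ payoff G c i
    changes c ¬happy with absorbed c ¬happy | ¬AllHappy⇒∃unhappy G ¬happy
    ... | d , c↝d , happy | k , hk =
      d , c↝d , k , λ eq → contradiction (trans (sym (happy k)) (trans eq hk)) λ ()
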